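{- Let $A$ be a finite nonempty set of positive integers and $p$ a positive integer such that $w^A(n)=w^A(n+p)$ for all $n\ge0$ (i.e. $w^A$ is periodic over $p$ and $\operatorname{preper}(A)=0$). Then for every $x\in A$ and every integer $k\geq1$, $b=kp+x$ is an extension of $A$, i.e. $w^{A\cup\{b\}}(n)=w^A(n)$ for all $n$.
   Context: For a finite nonempty set $B$ of positive integers, $w^B:\mathbb{Z}\to\{0,1\}$ is defined by $w^B(n)=1$ for $n<0$ and $w^B(n)=1-\min\{w^B(n-y):y\in B\}$ for $n\ge0$. An integer $b$ is an extension of $A$ if $w^{A\cup\{b\}}=w^A$. -}

module Defs where

open import Data.Nat using (ℕ; zero; suc; _+_; _*_; _∸_; _⊓_; _<_; _≤?_)
open import Data.Integer as ℤ using (ℤ; +_; -[1+_])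
open import Data.List using (List; []; _∷_; map)
open import Relation.Nullary using (yes; no)

-- Minimum of a list of values in {0,1}; the empty minimum is 1
-- (only used for nonempty B in the statement).
min01 : List ℕ → ℕ
min01 []       = 1
min01 (v ∷ vs) = v ⊓ min01 vs

-- lookback hist y : hist = [w(n-1), w(n-2), ..., w(0)] (values at n-1 down to 0);
-- returns w(n - y) for y ≥ 1, and 1 when n - y < 0.
lookback : List ℕ → ℕ → ℕ
lookback hist       zero    = 1   -- y = 0 never occurs for positive B
lookback []         (suc y) = 1
lookback (v ∷ hist) (suc zero) = v
lookback (v ∷ hist) (suc (suc y)) = lookback hist (suc y)

history : List ℕ → ℕ → List ℕ
history B zero    = []
history B (suc n) = let h = history B n in (1 ∸ min01 (map (lookback h) B)) ∷ h

wℕ : List ℕ → ℕ → ℕ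
wℕ B n = 1 ∸ min01 (map (lookback (history B n)) B)

w : List ℕ → ℤ → ℕ
w B (+ n)      = wℕ B n
w B -[1+ n ]   = 1

-- Adding b = k p + x to A cannot lower min { w(n - y) : y ∈ A }, since already
-- w(n - x) ≤ w(n - b): either n - b < 0 and w(n - b) = 1, or n - b ≥ 0 and
-- w(n - b) = w(n - b + k p) = w(n - x) by periodicity from 0 on. By induction
-- on n, the two recursions for w^A and w^{A ∪ {b}} therefore coincide.
module Submission where

open import Defs
open import Data.Nat using (ℕ; zero; suc; _+_; _*_; _<_; _≤_; _∸_; z≤n; s≤s; _≤?_)
open import Data.Nat.Properties
open import Data.Integer using (ℤ; +_; -[1+_])
open import Data.List using (List; _∷_; []; map)
open import Data.List.Membership.Propositional using (_∈_)
open import Data.List.Relation.Unary.Any using (here; there)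
open import Data.Product using (_,_)
open import Relation.Binary.PropositionalEquality
  using (_≡_; _≢_; refl; sym; trans; cong; module ≡-Reasoning)
open import Relation.Nullary using (yes; no)

min01-map-≤ : ∀ (f : ℕ → ℕ) {A x} → x ∈ A → min01 (map f A) ≤ f x
min01-map-≤ f {a ∷ A} (here refl) = m⊓n≤m (f a) _
min01-map-≤ f {a ∷ A} (there x∈A) = ≤-trans (m⊓n≤n (f a) _) (min01-map-≤ f x∈A)

min01-map-∷-dominated : ∀ (f : ℕ → ℕ) {A x} b → x ∈ A → f x ≤ f b →
  min01 (map f (b ∷ A)) ≡ min01 (map f A)
min01-map-∷-dominated f b x∈A fx≤fb = m≥n⇒m⊓n≡n (≤-trans (min01-map-≤ f x∈A) fx≤fb)

wℕ≤1 : ∀ B n → wℕ B n ≤ 1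
wℕ≤1 B n = m∸n≤m 1 (min01 (map (lookback (history B n)) B))

lookback-history≤1 : ∀ B n y → lookback (history B n) y ≤ 1
lookback-history≤1 B n       zero          = ≤-refl
lookback-history≤1 B zero    (suc y)       = ≤-refl
lookback-history≤1 B (suc n) (suc zero)    = wℕ≤1 B n
lookback-history≤1 B (suc n) (suc (suc y)) = lookback-history≤1 B n (suc y)

lookback-history-+ : ∀ B y d → 0 < y → lookback (history B (y + d)) y ≡ wℕ B d
lookback-history-+ B (suc zero)    d _ = refl
lookback-history-+ B (suc (suc y)) d _ = lookback-history-+ B (suc y) d (s≤s z≤n)

lookback-history-< : ∀ B n y → n < y → lookback (history B n) y ≡ 1
lookback-history-< B zero    (suc y)       _          = refl
lookback-history-< B (suc n) (suc (suc y)) (s≤s n<y) = lookback-history-< B n (suc y) n<y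

Dominated : List ℕ → ℕ → ℕ → Set
Dominated A b x = ∀ n → lookback (history A n) x ≤ lookback (history A n) b

module _ {A : List ℕ} {b x : ℕ} (x∈A : x ∈ A) (dom : Dominated A b x) where

  history-∷-dominated : ∀ n → history (b ∷ A) n ≡ history A n
  history-∷-dominated zero    = refl
  history-∷-dominated (suc n) rewrite history-∷-dominated n =
    cong (λ m → (1 ∸ m) ∷ history A n)
         (min01-map-∷-dominated (lookback (history A n)) b x∈A (dom n))

  w-∷-dominated : ∀ n → w (b ∷ A) n ≡ w A n
  w-∷-dominated (+ n) rewrite history-∷-dominated n =
    cong (1 ∸_) (min01-map-∷-dominated (lookback (history A n)) b x∈A (dom n))
  w-∷-dominated -[1+ n ] = refl

PeriodicFrom0 : List ℕ → ℕ → Set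
PeriodicFrom0 A p = ∀ n → wℕ A n ≡ wℕ A (n + p)

wℕ-periodic-* : ∀ A p → PeriodicFrom0 A p → ∀ k m → wℕ A (k * p + m) ≡ wℕ A m
wℕ-periodic-* _ _ per zero    m = refl
wℕ-periodic-* A p per (suc k) m = begin
  wℕ A (p + k * p + m)   ≡⟨ cong (wℕ A) (trans (+-assoc p (k * p) m) (+-comm p _)) ⟩
  wℕ A (k * p + m + p)   ≡⟨ sym (per (k * p + m)) ⟩
  wℕ A (k * p + m)       ≡⟨ wℕ-periodic-* A p per k m ⟩
  wℕ A m                 ∎
  where open ≡-Reasoning

periodic-dominated : ∀ A p → PeriodicFrom0 A p → ∀ k x → 0 < x → Dominated A (k * p + x) x
periodic-dominated A p per k x 0<x n with k * p + x ≤? n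
... | no  b≰n rewrite lookback-history-< A n (k * p + x) (≰⇒> b≰n) = lookback-history≤1 A n x
... | yes b≤n with d , refl ← m≤n⇒∃[o]m+o≡n b≤n = ≤-reflexive (begin
  lookback (history A (k * p + x + d)) x        ≡⟨ cong (λ m → lookback (history A m) x) reassoc ⟩
  lookback (history A (x + (k * p + d))) x      ≡⟨ lookback-history-+ A x (k * p + d) 0<x ⟩
  wℕ A (k * p + d)                              ≡⟨ wℕ-periodic-* A p per k d ⟩
  wℕ A d                                        ≡⟨ sym (lookback-history-+ A (k * p + x) d 0<b) ⟩
  lookback (history A (k * p + x + d)) (k * p + x) ∎)
  where
  open ≡-Reasoning
  0<b : 0 < k * p + x
  0<b = <-≤-trans 0<x (m≤n+m x (k * p))
  reassoc : k * p + x + d ≡ x + (k * p + d)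
  reassoc = trans (cong (_+ d) (+-comm (k * p) x)) (+-assoc x (k * p) d)

proposition2p14 : (A : List ℕ) → A ≢ [] → (∀ y → y ∈ A → 0 < y) →
    (p : ℕ) → 0 < p → (∀ n → w A (+ n) ≡ w A (+ (n + p))) →
    ∀ x → x ∈ A → ∀ k → 1 ≤ k → ∀ (n : ℤ) → w ((k * p + x) ∷ A) n ≡ w A n
proposition2p14 A _ pos p _ per x x∈A k _ =
  w-∷-dominated x∈A (periodic-dominated A p per k x (pos x x∈A))
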